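{- Let $H$ be a hypergroup and $\equiv$ a congruence relation on $H$. Then the canonical projection $\pi:H\to H/\equiv$, $a\mapsto[a]$, is a strict homomorphism of hypergroups. In particular, $H/\operatorname{Ker}(\pi)$ is isomorphic to $H/\equiv$.
   Context: A hypergroup is a nonempty set $H$ with a hyperoperation $*$ from $H\times H$ to nonempty subsets of $H$ (extended to subsets by unions) which is associative, has a unique identity $e$ ($e*x=x*e=\{x\}$), unique inverses ($e\in(f^{ -1}*f)\cap(f*f^{ -1})$), and is reversible ($c\in a*b\Rightarrow a\in c*b^{ -1}$ and $b\in a^{ -1}*c$). For an equivalence relation $\equiv$ and subsets $A,B$, $A\equiv B$ means: for every $a\in A$, $b\in B$ there exist $b'\in A$, $a'\in B$ with $a\equiv a'$, $b\equiv b'$. A congruence relation is an equivalence relation with (1) $a\equiv x,b\equiv y\Rightarrow a*b\equiv x*y$ and $b*a\equiv y*x$; (2) $a\equiv b\Rightarrow a^{ -1}\equiv b^{ -1}$. $H/\equiv$ is the set of classes $[a]$ with hyperoperation $[x]\boxdot[y]=\{[z]:z\in x'*y',\ [x']=[x],[y']=[y]\}$ (a hypergroup with identity $[e]$). A homomorphism of hypergroups is a map $f$ with $f(a*b)\subseteq f(a)*f(b)$; it is strict if equality holds for all $a,b$; an isomorphism is a bijective strict homomorphism. $\operatorname{Ker}(\pi)=\{a\in H:\pi(a)=[e]\}$, and for a normal sub-hypergroup $N$ (i.e. $hN=Nh$ for all $h$), $H/N$ denotes the set of cosets $hN$ with hyperoperation $(pN)(qN)=\{rN:r\in pN*qN\}$.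 -}

module Defs where

open import Level using (Level; _⊔_)
open import Function using (id)
open import Data.Product using (Σ; ∃; _×_; _,_)
open import Relation.Binary.Core using (Rel)
open import Relation.Binary.Structures using (IsEquivalence)
open import Relation.Binary.PropositionalEquality using (_≡_)
open import Relation.Unary using (Pred; _∈_; ｛_｝)

private
  variable
    a b c ℓ ℓ₁ ℓ₂ r : Level

_≐'_ : {A : Set a} → Pred A ℓ₁ → Pred A ℓ₂ → Set (a ⊔ ℓ₁ ⊔ ℓ₂)
P ≐' Q = (∀ x → x ∈ P → x ∈ Q) × (∀ x → x ∈ Q → x ∈ P)

liftHyp : {A : Set a} → (A → A → Pred A ℓ) → Pred A ℓ₁ → Pred A ℓ₂ → Pred A (a ⊔ ℓ ⊔ ℓ₁ ⊔ ℓ₂)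
liftHyp _*_ P Q z = ∃ λ x → ∃ λ y → x ∈ P × y ∈ Q × z ∈ (x * y)

record Hypergroup (c ℓ : Level) : Set (Level.suc (c ⊔ ℓ)) where
  field
    Carrier   : Set c
    _*_       : Carrier → Carrier → Pred Carrier ℓ
    nonempty  : ∀ x y → ∃ λ z → z ∈ (x * y)
    assoc     : ∀ x y z → liftHyp _*_ (x * y) ｛ z ｝ ≐' liftHyp _*_ ｛ x ｝ (y * z)
    e         : Carrier
    identityˡ : ∀ x → (e * x) ≐' ｛ x ｝
    identityʳ : ∀ x → (x * e) ≐' ｛ x ｝
    identity-unique : ∀ e′ → (∀ x → ((e′ * x) ≐' ｛ x ｝) × ((x * e′) ≐' ｛ x ｝)) → e′ ≡ e
    _⁻¹       : Carrier → Carrier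
    inverse   : ∀ f → e ∈ ((f ⁻¹) * f) × e ∈ (f * (f ⁻¹))
    inverse-unique : ∀ f g → e ∈ (g * f) → e ∈ (f * g) → g ≡ f ⁻¹
    reversible : ∀ x y z → z ∈ (x * y) → x ∈ (z * (y ⁻¹)) × y ∈ ((x ⁻¹) * z)

SetEquiv : {A : Set a} → Rel A r → Pred A ℓ₁ → Pred A ℓ₂ → Set (a ⊔ r ⊔ ℓ₁ ⊔ ℓ₂)
SetEquiv _≈_ P Q = ∀ x y → x ∈ P → y ∈ Q →
  ∃ λ y′ → ∃ λ x′ → y′ ∈ P × x′ ∈ Q × (x ≈ x′) × (y ≈ y′)

record IsCongruence {c ℓ r} (H : Hypergroup c ℓ) (_≈_ : Rel (Hypergroup.Carrier H) r)
       : Set (c ⊔ ℓ ⊔ r) where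
  open Hypergroup H
  field
    isEquivalence : IsEquivalence _≈_
    *-compat : ∀ x y x′ y′ → x ≈ x′ → y ≈ y′ →
               SetEquiv _≈_ (x * y) (x′ * y′) × SetEquiv _≈_ (y * x) (y′ * x′)
    ⁻¹-compat : ∀ x y → x ≈ y → (x ⁻¹) ≈ (y ⁻¹)

-- Hyperstructures on a setoid: used to represent quotient objects
-- (H/≡ and H/N) without quotient types. Elements of the quotient are
-- represented by elements of H, with equality = equality of classes.

record SetoidHyp (c r ℓ : Level) : Set (Level.suc (c ⊔ r ⊔ ℓ)) where
  field
    Carrier : Set c
    _≈_     : Rel Carrier r
    isEquivalence : IsEquivalence _≈_
    _⊙_     : Carrier → Carrier → Pred Carrier ℓ

toSetoidHyp : ∀ {c ℓ} → Hypergroup c ℓ → SetoidHyp c c ℓ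
toSetoidHyp H = record
  { Carrier = Carrier ; _≈_ = _≡_
  ; isEquivalence = Relation.Binary.PropositionalEquality.isEquivalence
  ; _⊙_ = _*_ }
  where open Hypergroup H

quotient : ∀ {c ℓ r} (H : Hypergroup c ℓ) (_≈_ : Rel (Hypergroup.Carrier H) r) →
           IsCongruence H _≈_ → SetoidHyp c r (c ⊔ ℓ ⊔ r)
quotient H _≈_ cong = record
  { Carrier = Carrier ; _≈_ = _≈_
  ; isEquivalence = IsCongruence.isEquivalence cong
  ; _⊙_ = λ x y w → ∃ λ x′ → ∃ λ y′ → ∃ λ z →
            (x′ ≈ x) × (y′ ≈ y) × (w ≈ z) × z ∈ (x′ * y′) }
  where open Hypergroup H

leftCoset : ∀ {c ℓ ℓ₁} (H : Hypergroup c ℓ) → Hypergroup.Carrier H →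
            Pred (Hypergroup.Carrier H) ℓ₁ → Pred (Hypergroup.Carrier H) _
leftCoset H h N = liftHyp (Hypergroup._*_ H) ｛ h ｝ N

rightCoset : ∀ {c ℓ ℓ₁} (H : Hypergroup c ℓ) → Hypergroup.Carrier H →
             Pred (Hypergroup.Carrier H) ℓ₁ → Pred (Hypergroup.Carrier H) _
rightCoset H h N = liftHyp (Hypergroup._*_ H) N ｛ h ｝

IsNormal : ∀ {c ℓ ℓ₁} (H : Hypergroup c ℓ) → Pred (Hypergroup.Carrier H) ℓ₁ → Set _
IsNormal H N = ∀ h → leftCoset H h N ≐' rightCoset H h N

cosetQuotient : ∀ {c ℓ ℓ₁} (H : Hypergroup c ℓ) → Pred (Hypergroup.Carrier H) ℓ₁ →
                SetoidHyp c (c ⊔ ℓ ⊔ ℓ₁) (c ⊔ ℓ ⊔ ℓ₁)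
cosetQuotient H N = record
  { Carrier = Carrier
  ; _≈_ = λ p q → leftCoset H p N ≐' leftCoset H q N
  ; isEquivalence = record
      { refl  = (λ _ z → z) , (λ _ z → z)
      ; sym   = λ { (f , g) → g , f }
      ; trans = λ { (f , g) (f′ , g′) → (λ x z → f′ x (f x z)) , (λ x z → g x (g′ x z)) } }
  ; _⊙_ = λ p q w → ∃ λ r → (leftCoset H w N ≐' leftCoset H r N) ×
                     r ∈ liftHyp _*_ (leftCoset H p N) (leftCoset H q N) }
  where open Hypergroup H

module _ {c₁ r₁ ℓ₁ c₂ r₂ ℓ₂} (K : SetoidHyp c₁ r₁ ℓ₁) (L : SetoidHyp c₂ r₂ ℓ₂) where
  private
    module K = SetoidHyp K
    module L = SetoidHyp L

  image : ∀ {ℓ} → (K.Carrier → L.Carrier) → Pred K.Carrier ℓ → Pred L.Carrier _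
  image f A y = ∃ λ x → x ∈ A × (y L.≈ f x)

  IsMap : (K.Carrier → L.Carrier) → Set _
  IsMap f = ∀ x y → x K.≈ y → f x L.≈ f y

  IsHomomorphism : (K.Carrier → L.Carrier) → Set _
  IsHomomorphism f = IsMap f × (∀ x y → ∀ w → w ∈ image f (x K.⊙ y) → w ∈ (f x L.⊙ f y))

  IsStrictHomomorphism : (K.Carrier → L.Carrier) → Set _
  IsStrictHomomorphism f = IsMap f × (∀ x y → image f (x K.⊙ y) ≐' (f x L.⊙ f y))

  IsIsomorphism : (K.Carrier → L.Carrier) → Set _
  IsIsomorphism f = IsStrictHomomorphism f
                  × (∀ x y → f x L.≈ f y → x K.≈ y)
                  × (∀ y → ∃ λ x → f x L.≈ y)

  kernel : (K.Carrier → L.Carrier) → L.Carrier → Pred K.Carrier r₂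
  kernel f eL x = f x L.≈ eL

-- The congruence class of q coincides with both cosets q·Ker π and Ker π·q:
-- transporting e ∈ q⁻¹ q along w ≈ q and applying reversibility puts w into
-- q·Ker π, and conversely w ∈ q k with k ≈ e transports into q e = {q}.
-- Hence Ker π is normal, equality of cosets is the congruence itself, and the
-- identity on representatives is an isomorphism H/Ker π → H/≡.
module Submission where

open import Level using (_⊔_)
open import Defs
open import Function using (id; _⇔_; mk⇔; Equivalence)
open import Data.Product using (∃; _×_; _,_; proj₁; proj₂)
open import Relation.Binary.Core using (Rel)
open import Relation.Binary.Structures using (IsEquivalence)
open import Relation.Binary.PropositionalEquality using (_≡_; refl) renaming (sym to ≡-sym)
open import Relation.Unary using (Pred; _∈_)

module HypergroupProperties {c ℓ} (H : Hypergroup c ℓ) where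
  open Hypergroup H

  ⁻¹-involutive : ∀ h → h ≡ (h ⁻¹) ⁻¹
  ⁻¹-involutive h = inverse-unique (h ⁻¹) h (proj₂ (inverse h)) (proj₁ (inverse h))

module CongruenceProperties {c ℓ r} (H : Hypergroup c ℓ) (_≈_ : Rel (Hypergroup.Carrier H) r)
                            (cong : IsCongruence H _≈_) where
  open Hypergroup H
  open HypergroupProperties H
  open IsCongruence cong
  open IsEquivalence isEquivalence
    renaming (refl to ≈-refl; sym to ≈-sym; trans to ≈-trans; reflexive to ≡⇒≈)

  H/≈ : SetoidHyp c r (c ⊔ ℓ ⊔ r)
  H/≈ = quotient H _≈_ cong

  Ker : Pred Carrier r
  Ker = kernel (toSetoidHyp H) H/≈ id e

  H/Ker : SetoidHyp c (c ⊔ ℓ ⊔ r) (c ⊔ ℓ ⊔ r)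
  H/Ker = cosetQuotient H Ker

  -- SetEquiv only speaks about pairs of elements, so the second factor's
  -- product must be inhabited (nonempty) before it yields anything.
  *-cong-∈ : ∀ {x y x′ y′ z} → x ≈ x′ → y ≈ y′ → z ∈ (x * y) →
             ∃ λ z′ → z′ ∈ (x′ * y′) × z ≈ z′
  *-cong-∈ {x′ = x′} {y′} {z} x≈x′ y≈y′ z∈xy with nonempty x′ y′
  ... | b , b∈ with proj₁ (*-compat _ _ x′ y′ x≈x′ y≈y′) z b z∈xy b∈
  ... | _ , z′ , _ , z′∈ , z≈z′ , _ = z′ , z′∈ , z≈z′

  leftCoset-Ker : ∀ q → leftCoset H q Ker ≐' (_≈ q)
  leftCoset-Ker q = ⊆class , class⊆
    where
    ⊆class : ∀ w → w ∈ leftCoset H q Ker → w ≈ q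
    ⊆class w (_ , k , refl , k≈e , w∈qk) with *-cong-∈ ≈-refl k≈e w∈qk
    ... | z , z∈qe , w≈z = ≈-trans w≈z (≡⇒≈ (≡-sym (proj₁ (identityʳ q) z z∈qe)))
    class⊆ : ∀ w → w ≈ q → w ∈ leftCoset H q Ker
    class⊆ w w≈q with *-cong-∈ ≈-refl (≈-sym w≈q) (proj₁ (inverse q))
    ... | k , k∈q⁻¹w , e≈k =
      (q ⁻¹) ⁻¹ , k , ⁻¹-involutive q , ≈-sym e≈k , proj₂ (reversible (q ⁻¹) w k k∈q⁻¹w)

  rightCoset-Ker : ∀ q → rightCoset H q Ker ≐' (_≈ q)
  rightCoset-Ker q = ⊆class , class⊆
    where
    ⊆class : ∀ w → w ∈ rightCoset H q Ker → w ≈ q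
    ⊆class w (k , _ , k≈e , refl , w∈kq) with *-cong-∈ k≈e ≈-refl w∈kq
    ... | z , z∈eq , w≈z = ≈-trans w≈z (≡⇒≈ (≡-sym (proj₁ (identityˡ q) z z∈eq)))
    class⊆ : ∀ w → w ≈ q → w ∈ rightCoset H q Ker
    class⊆ w w≈q with *-cong-∈ (≈-sym w≈q) ≈-refl (proj₂ (inverse q))
    ... | k , k∈wq⁻¹ , e≈k =
      k , (q ⁻¹) ⁻¹ , ≈-sym e≈k , ⁻¹-involutive q , proj₁ (reversible w (q ⁻¹) k k∈wq⁻¹)

  Ker-normal : IsNormal H Ker
  Ker-normal q =
    (λ w w∈qK → proj₂ (rightCoset-Ker q) w (proj₁ (leftCoset-Ker q) w w∈qK)) ,
    (λ w w∈Kq → proj₂ (leftCoset-Ker q) w (proj₁ (rightCoset-Ker q) w w∈Kq))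

  leftCoset-Ker-≐'⇔≈ : ∀ p q → (leftCoset H p Ker ≐' leftCoset H q Ker) ⇔ (p ≈ q)
  leftCoset-Ker-≐'⇔≈ p q = mk⇔ to from
    where
    to : leftCoset H p Ker ≐' leftCoset H q Ker → p ≈ q
    to (pK⊆qK , _) = proj₁ (leftCoset-Ker q) p (pK⊆qK p (proj₂ (leftCoset-Ker p) p ≈-refl))
    from : p ≈ q → leftCoset H p Ker ≐' leftCoset H q Ker
    from p≈q =
      (λ w w∈pK → proj₂ (leftCoset-Ker q) w (≈-trans (proj₁ (leftCoset-Ker p) w w∈pK) p≈q)) ,
      (λ w w∈qK → proj₂ (leftCoset-Ker p) w (≈-trans (proj₁ (leftCoset-Ker q) w w∈qK) (≈-sym p≈q)))

  π-strict : IsStrictHomomorphism (toSetoidHyp H) H/≈ id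
  π-strict = (λ x y x≡y → ≡⇒≈ x≡y) , λ x y → image⊆ x y , ⊆image x y
    where
    image⊆ : ∀ x y w → w ∈ image (toSetoidHyp H) H/≈ id (x * y) → w ∈ SetoidHyp._⊙_ H/≈ x y
    image⊆ x y w (z , z∈xy , w≈z) = x , y , z , ≈-refl , ≈-refl , w≈z , z∈xy
    ⊆image : ∀ x y w → w ∈ SetoidHyp._⊙_ H/≈ x y → w ∈ image (toSetoidHyp H) H/≈ id (x * y)
    ⊆image x y w (x′ , y′ , z , x′≈x , y′≈y , w≈z , z∈x′y′) with *-cong-∈ x′≈x y′≈y z∈x′y′
    ... | z′ , z′∈xy , z≈z′ = z′ , z′∈xy , ≈-trans w≈z z≈z′

  id-H/Ker→H/≈-isomorphism : IsIsomorphism H/Ker H/≈ id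
  id-H/Ker→H/≈-isomorphism =
    ((λ p q → Equivalence.to (leftCoset-Ker-≐'⇔≈ p q)) , λ x y → image⊆ x y , ⊆image x y) ,
    (λ p q → Equivalence.from (leftCoset-Ker-≐'⇔≈ p q)) ,
    (λ q → q , ≈-refl)
    where
    image⊆ : ∀ x y w → w ∈ image H/Ker H/≈ id (SetoidHyp._⊙_ H/Ker x y) → w ∈ SetoidHyp._⊙_ H/≈ x y
    image⊆ x y w (z , (t , zK≐tK , (a , b , a∈xK , b∈yK , t∈ab)) , w≈z) =
      a , b , t ,
      proj₁ (leftCoset-Ker x) a a∈xK , proj₁ (leftCoset-Ker y) b b∈yK ,
      ≈-trans w≈z (Equivalence.to (leftCoset-Ker-≐'⇔≈ z t) zK≐tK) , t∈ab
    ⊆image : ∀ x y w → w ∈ SetoidHyp._⊙_ H/≈ x y → w ∈ image H/Ker H/≈ id (SetoidHyp._⊙_ H/Ker x y)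
    ⊆image x y w (x′ , y′ , z , x′≈x , y′≈y , w≈z , z∈x′y′) =
      z ,
      (z , Equivalence.from (leftCoset-Ker-≐'⇔≈ z z) ≈-refl ,
           (x′ , y′ , proj₂ (leftCoset-Ker x) x′ x′≈x , proj₂ (leftCoset-Ker y) y′ y′≈y , z∈x′y′)) ,
      w≈z

proposition4p14 : ∀ {c ℓ r} (H : Hypergroup c ℓ) (_≈_ : Rel (Hypergroup.Carrier H) r)
    → (cong : IsCongruence H _≈_)
    → IsStrictHomomorphism (toSetoidHyp H) (quotient H _≈_ cong) id
      × IsNormal H (kernel (toSetoidHyp H) (quotient H _≈_ cong) id (Hypergroup.e H))
      × ∃ λ f → IsIsomorphism
          (cosetQuotient H (kernel (toSetoidHyp H) (quotient H _≈_ cong) id (Hypergroup.e H)))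
          (quotient H _≈_ cong) f
proposition4p14 H _≈_ cong = π-strict , Ker-normal , id , id-H/Ker→H/≈-isomorphism
  where open CongruenceProperties H _≈_ cong
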